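{- Let $G$ be a connected graph with $n \ge 4$ vertices and $e(G) \ge \binom{n-1}{2} + 2$. Then $md(G) = 1$. Moreover, the lower bound on $e(G)$ is sharp: the graph obtained from $K_{n-1}$ by adding a pendent edge has $\binom{n-1}{2}+1$ edges and monochromatic disconnection number $2$.
   Context: All graphs are finite and simple; $e(G)$ is the number of edges. An edge-coloring of a graph $G$ is a map $\Gamma: E(G) \to [k]$ (adjacent edges may receive the same color). An edge-cut is monochromatic if all of its edges have the same color. An edge-coloring is a monochromatic disconnection coloring (MD-coloring) if any two distinct vertices $u,v$ are separated by a monochromatic edge-cut (equivalently, for some color $i$, $u$ and $v$ lie in different components of the graph obtained by deleting all edges of color $i$). For a connected graph $G$, $md(G)$ is the maximum number of colors in an MD-coloring of $G$. -}

module Defs where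

open import Data.Nat using (ℕ; zero; suc; _+_; _∸_; _<ᵇ_; _≡ᵇ_)
open import Data.Bool using (Bool; true; false; not; _∧_; _∨_; if_then_else_)
open import Data.Bool.Properties using (∨-comm)
open import Data.Fin using (Fin; toℕ)
open import Data.List using (List; map; allFin)
open import Data.Nat.ListAction using (sum)
open import Data.Product using (Σ; ∃; ∃-syntax; _×_; _,_)
open import Relation.Binary.PropositionalEquality using (_≡_; _≢_; refl; cong; cong₂)
open import Relation.Nullary using (¬_)

record Graph (n : ℕ) : Set where
  field
    adj     : Fin n → Fin n → Bool
    adj-sym : ∀ x y → adj x y ≡ adj y x
    adj-irr : ∀ x → adj x x ≡ false
open Graph public

e : ∀ {n} → Graph n → ℕ
e {n} G = sum (map (λ x → sum (map (λ y →
            if (toℕ x <ᵇ toℕ y) ∧ adj G x y then 1 else 0) (allFin n))) (allFin n))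

data Reach {n : ℕ} (R : Fin n → Fin n → Set) : Fin n → Fin n → Set where
  here : ∀ {u} → Reach R u u
  step : ∀ {u w v} → R u w → Reach R w v → Reach R u v

Edge : ∀ {n} → Graph n → Fin n → Fin n → Set
Edge G x y = adj G x y ≡ true

Connected : ∀ {n} → Graph n → Set
Connected {n} G = ∀ (u v : Fin n) → Reach (Edge G) u v

-- An edge-coloring with colors in Fin k (value on non-edges irrelevant; symmetric on edges).
record Coloring {n : ℕ} (G : Graph n) (k : ℕ) : Set where
  field
    col     : Fin n → Fin n → Fin k
    col-sym : ∀ x y → Edge G x y → col x y ≡ col y x
open Coloring public

UsesAll : ∀ {n k} {G : Graph n} → Coloring G k → Set
UsesAll {n} {k} {G} Γ = ∀ (c : Fin k) → ∃[ x ] ∃[ y ] (Edge G x y × col Γ x y ≡ c)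

Without : ∀ {n k} {G : Graph n} → Coloring G k → Fin k → Fin n → Fin n → Set
Without {G = G} Γ i x y = Edge G x y × col Γ x y ≢ i

IsMD : ∀ {n k} {G : Graph n} → Coloring G k → Set
IsMD {n} {k} Γ = ∀ (u v : Fin n) → u ≢ v → ∃[ i ] ¬ Reach (Without Γ i) u v

MDColoring : ∀ {n} → Graph n → ℕ → Set
MDColoring G k = Σ (Coloring G k) (λ Γ → UsesAll Γ × IsMD Γ)

MdIs : ∀ {n} → Graph n → ℕ → Set
MdIs G m = MDColoring G m × (∀ k → MDColoring G k → k Data.Nat.≤ m)

choose2 : ℕ → ℕ
choose2 zero    = zero
choose2 (suc m) = m + choose2 m

-- K_{n-1} on vertices 0..n-2 plus the pendant edge {0, n-1}.
≡ᵇ-sym : ∀ a b → (a ≡ᵇ b) ≡ (b ≡ᵇ a)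
≡ᵇ-sym zero zero = refl
≡ᵇ-sym zero (suc b) = refl
≡ᵇ-sym (suc a) zero = refl
≡ᵇ-sym (suc a) (suc b) = ≡ᵇ-sym a b

≡ᵇ-refl : ∀ a → (a ≡ᵇ a) ≡ true
≡ᵇ-refl zero = refl
≡ᵇ-refl (suc a) = ≡ᵇ-refl a

module _ (n : ℕ) where
  isLast : Fin n → Bool
  isLast x = toℕ x ≡ᵇ (n ∸ 1)

  P : Fin n → Fin n → Bool
  P x y = (not (isLast x) ∧ not (isLast y)) ∨ (isLast x ∧ (toℕ y ≡ᵇ 0))

  pAdj : Fin n → Fin n → Bool
  pAdj x y = not (toℕ x ≡ᵇ toℕ y) ∧ (P x y ∨ P y x)

  pendantK : Graph n
  pendantK = record
    { adj = pAdj
    ; adj-sym = λ x y → cong₂ _∧_ (cong not (≡ᵇ-sym (toℕ x) (toℕ y))) (∨-comm (P x y) (P y x))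
    ; adj-irr = λ x → cong (λ a → not a ∧ (P x x ∨ P x x)) (≡ᵇ-refl (toℕ x))
    }

module Submission where

-- In an MD-colouring the colour separating the ends of an edge uv is the colour
-- of uv itself, and it also occurs on every other u–v path of length two; hence triangles
-- are monochromatic.  So two edges xy, xz at a common vertex get the same colour as soon as
-- y, z are adjacent or x, y, z have a common neighbour.  If neither holds (a "cherry"),
-- every other vertex misses one of x, y, z, and a degree count based on the handshake lemma
-- gives e(G) ≤ C(n − 1, 2) + 1.  So when e(G) ≥ C(n − 1, 2) + 2, all edges at a vertex share
-- a colour, by connectivity all edges do, and md(G) = 1.
-- Sharpness.  For K_{n−1} plus a pendant edge all degrees are explicit, so the handshake
-- lemma gives e = C(n − 1, 2) + 1.  Colouring the pendant edge 1 and the clique 0 is an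
-- MD-colouring; conversely the clique is monochromatic in every MD-colouring (its triangles
-- are), so at most two colours occur: md = 2.

open import Defs
open import Data.Bool using (Bool; true; false; _∧_; _∨_; if_then_else_)
import Data.Bool as Bool
open import Data.Bool.Properties using (∨-comm; ¬-not; T-≡)
open import Data.Fin using (Fin; zero; suc; toℕ; fromℕ)
open import Data.Fin.Properties using (_≟_; toℕ-injective; toℕ-fromℕ; any?; injective⇒≤)
open import Data.List using (map; allFin; tabulate)
open import Data.List.Properties using (map-tabulate)
import Data.Nat.ListAction as List
open import Data.Nat using (ℕ; zero; suc; _+_; _*_; _∸_; _≤_; z≤n; s≤s; _<ᵇ_; _≡ᵇ_)
open import Data.Nat.Properties hiding (_≟_)
open import Data.Nat.Tactic.RingSolver using (solve-∀)
open import Data.Product using (_×_; _,_; ∃-syntax; proj₁; proj₂)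
open import Data.Sum using (_⊎_; inj₁; inj₂; [_,_])
open import Function using (_∘_; id)
open import Function.Bundles using (Equivalence)
open import Relation.Binary.PropositionalEquality
  using (_≡_; _≢_; refl; sym; trans; cong; cong₂; subst; subst₂; module ≡-Reasoning)
open import Relation.Nullary using (¬_; Dec; yes; no; does; contradiction; _×-dec_)
open import Relation.Nullary.Reflects using (ofʸ; ofⁿ)
open import Algebra.Properties.CommutativeSemigroup +-commutativeSemigroup using (xy∙z≈xz∙y)
open import Algebra.Properties.Semiring.Sum +-*-semiring
  using (sum-syntax; ∑-distrib-+; ∑-comm; sum-cong-≗; sum-replicate-zero; *-distribˡ-sum)

𝟙 : Bool → ℕ
𝟙 b = if b then 1 else 0

𝟙≤1 : ∀ b → 𝟙 b ≤ 1
𝟙≤1 true  = ≤-refl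
𝟙≤1 false = z≤n

𝟙-two-of-three : ∀ p q r → ¬ (p ≡ true × q ≡ true × r ≡ true) → 𝟙 p + 𝟙 q + 𝟙 r ≤ 2
𝟙-two-of-three true  true  true  not-all = contradiction (refl , refl , refl) not-all
𝟙-two-of-three true  true  false _ = ≤-refl
𝟙-two-of-three true  false r     _ = s≤s (𝟙≤1 r)
𝟙-two-of-three false q     r     _ = +-mono-≤ (𝟙≤1 q) (𝟙≤1 r)

listSum≡∑ : ∀ n (f : Fin n → ℕ) → List.sum (map f (allFin n)) ≡ ∑[ i < n ] f i
listSum≡∑ n f = trans (cong List.sum (map-tabulate id f)) (sum-tabulate n f)
  where
  sum-tabulate : ∀ n (f : Fin n → ℕ) → List.sum (tabulate f) ≡ ∑[ i < n ] f i
  sum-tabulate zero    f = refl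
  sum-tabulate (suc n) f = cong (f zero +_) (sum-tabulate n (f ∘ suc))

∑-mono : ∀ {n} {f g : Fin n → ℕ} → (∀ i → f i ≤ g i) → ∑[ i < n ] f i ≤ ∑[ i < n ] g i
∑-mono {zero}  f≤g = z≤n
∑-mono {suc n} f≤g = +-mono-≤ (f≤g zero) (∑-mono (f≤g ∘ suc))

∑-const : ∀ n c → ∑[ i < n ] c ≡ n * c
∑-const zero    c = refl
∑-const (suc n) c = cong (c +_) (∑-const n c)

∑-+₃ : ∀ {n} (f g h : Fin n → ℕ) →
       ∑[ i < n ] (f i + g i + h i) ≡ ∑[ i < n ] f i + ∑[ i < n ] g i + ∑[ i < n ] h i
∑-+₃ f g h = trans (∑-distrib-+ (λ i → f i + g i) h) (cong (_+ _) (∑-distrib-+ f g))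

δ : ∀ {n} → Fin n → Fin n → ℕ
δ t a = 𝟙 (does (a ≟ t))

δ-self : ∀ {n} (t : Fin n) → δ t t ≡ 1
δ-self t with t ≟ t
... | yes _  = refl
... | no t≢t = contradiction refl t≢t

δ-other : ∀ {n} {t a : Fin n} → a ≢ t → δ t a ≡ 0
δ-other {t = t} {a} a≢t with a ≟ t
... | yes a≡t = contradiction a≡t a≢t
... | no _    = refl

∑-δ* : ∀ {n} (t : Fin n) (h : Fin n → ℕ) → ∑[ a < n ] (δ t a * h a) ≡ h t
∑-δ* {suc n} zero    h = begin
  h zero + 0 + ∑[ a < n ] 0  ≡⟨ cong (h zero + 0 +_) (sum-replicate-zero n) ⟩
  h zero + 0 + 0             ≡⟨ cong (_+ 0) (+-identityʳ (h zero)) ⟩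
  h zero + 0                 ≡⟨ +-identityʳ (h zero) ⟩
  h zero                     ∎
  where open ≡-Reasoning
∑-δ* {suc n} (suc t) h = ∑-δ* t (h ∘ suc)

∑-δ : ∀ {n} (t : Fin n) → ∑[ a < n ] δ t a ≡ 1
∑-δ t = trans (sum-cong-≗ (λ a → sym (*-identityʳ (δ t a)))) (∑-δ* t (λ _ → 1))

half-≤ : ∀ {a b} → a + a ≤ b + b → a ≤ b
half-≤ a+a≤b+b = ≮⇒≥ (λ b<a → <⇒≱ (+-mono-< b<a b<a) a+a≤b+b)

half-≡ : ∀ {a b} → a + a ≡ b + b → a ≡ b
half-≡ eq = ≤-antisym (half-≤ (≤-reflexive eq)) (half-≤ (≤-reflexive (sym eq)))

choose2-double : ∀ k → choose2 (suc k) + choose2 (suc k) ≡ suc k * k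
choose2-double zero    = refl
choose2-double (suc k) = begin
  (suc k + C) + (suc k + C)  ≡⟨ regroup (suc k) C ⟩
  (suc k + suc k) + (C + C)  ≡⟨ cong (suc k + suc k +_) (choose2-double k) ⟩
  (suc k + suc k) + suc k * k ≡⟨ expand k ⟩
  suc (suc k) * suc k        ∎
  where
  open ≡-Reasoning
  C : ℕ
  C = choose2 (suc k)
  regroup : ∀ a b → (a + b) + (a + b) ≡ (a + a) + (b + b)
  regroup = solve-∀
  expand : ∀ k → (suc k + suc k) + suc k * k ≡ suc (suc k) * suc k
  expand = solve-∀

-- Degrees and the handshake lemma.
module _ {n : ℕ} (G : Graph n) where

  edge-sym : ∀ {a b} → Edge G a b → Edge G b a
  edge-sym {a} {b} a~b = trans (adj-sym G b a) a~b

  edge-≢ : ∀ {a b} → Edge G a b → a ≢ b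
  edge-≢ {a} a~a refl with trans (sym (adj-irr G a)) a~a
  ... | ()

  common-neighbour? : ∀ x y z w → Dec (Edge G x w × Edge G y w × Edge G z w)
  common-neighbour? x y z w =
    (adj G x w Bool.≟ true) ×-dec (adj G y w Bool.≟ true) ×-dec (adj G z w Bool.≟ true)

  deg : Fin n → ℕ
  deg a = ∑[ b < n ] 𝟙 (adj G a b)

  below : Fin n → Fin n → ℕ
  below a b = 𝟙 ((toℕ a <ᵇ toℕ b) ∧ adj G a b)

  e≡∑below : e G ≡ ∑[ a < n ] ∑[ b < n ] below a b
  e≡∑below = trans (listSum≡∑ n _) (sum-cong-≗ (λ a → listSum≡∑ n (below a)))

  edge-split : ∀ a b → 𝟙 (adj G a b) ≡ below a b + below b a
  edge-split a b rewrite adj-sym G b a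
    with toℕ a <ᵇ toℕ b | <ᵇ-reflects-< (toℕ a) (toℕ b)
       | toℕ b <ᵇ toℕ a | <ᵇ-reflects-< (toℕ b) (toℕ a)
  ... | true  | ofʸ a<b | true  | ofʸ b<a = contradiction b<a (<-asym a<b)
  ... | true  | _       | false | _       = sym (+-identityʳ _)
  ... | false | _       | true  | _       = refl
  ... | false | ofⁿ a≮b | false | ofⁿ b≮a
    with toℕ-injective (≤-antisym (≮⇒≥ b≮a) (≮⇒≥ a≮b))
  ...   | refl rewrite adj-irr G a = refl

  handshake : ∑[ a < n ] deg a ≡ e G + e G
  handshake = begin
    ∑[ a < n ] ∑[ b < n ] 𝟙 (adj G a b)
      ≡⟨ sum-cong-≗ (λ a → trans (sum-cong-≗ (edge-split a)) (∑-distrib-+ (below a) (λ b → below b a))) ⟩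
    ∑[ a < n ] (∑[ b < n ] below a b + ∑[ b < n ] below b a)
      ≡⟨ ∑-distrib-+ (λ a → ∑[ b < n ] below a b) (λ a → ∑[ b < n ] below b a) ⟩
    ∑[ a < n ] ∑[ b < n ] below a b + ∑[ a < n ] ∑[ b < n ] below b a
      ≡⟨ cong (∑[ a < n ] ∑[ b < n ] below a b +_) (∑-comm (λ a b → below b a)) ⟩
    ∑[ a < n ] ∑[ b < n ] below a b + ∑[ b < n ] ∑[ a < n ] below b a
      ≡⟨ cong₂ _+_ (sym e≡∑below) (sym e≡∑below) ⟩
    e G + e G ∎
    where open ≡-Reasoning

  row-with-two : ∀ a t → ∑[ b < n ] (𝟙 (adj G a b) + (δ a b + δ t b)) ≡ deg a + 2
  row-with-two a t = begin
    ∑[ b < n ] (𝟙 (adj G a b) + (δ a b + δ t b))  ≡⟨ ∑-distrib-+ (λ b → 𝟙 (adj G a b)) (λ b → δ a b + δ t b) ⟩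
    deg a + ∑[ b < n ] (δ a b + δ t b)            ≡⟨ cong (deg a +_) (∑-distrib-+ (δ a) (δ t)) ⟩
    deg a + (∑[ b < n ] δ a b + ∑[ b < n ] δ t b) ≡⟨ cong (deg a +_) (cong₂ _+_ (∑-δ a) (∑-δ t)) ⟩
    deg a + 2                                     ∎
    where open ≡-Reasoning

  deg-nonadj : ∀ {a t} → a ≢ t → adj G a t ≡ false → deg a + 2 ≤ n
  deg-nonadj {a} {t} a≢t a≁t = begin
    deg a + 2                                     ≡⟨ row-with-two a t ⟨
    ∑[ b < n ] (𝟙 (adj G a b) + (δ a b + δ t b))  ≤⟨ ∑-mono at-most-once ⟩
    ∑[ b < n ] 1                                  ≡⟨ trans (∑-const n 1) (*-identityʳ n) ⟩
    n                                             ∎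
    where
    open ≤-Reasoning
    at-most-once : ∀ b → 𝟙 (adj G a b) + (δ a b + δ t b) ≤ 1
    at-most-once b with b ≟ a | b ≟ t
    ... | yes refl | yes refl = contradiction refl a≢t
    ... | yes refl | no _     rewrite adj-irr G a = ≤-refl
    ... | no _     | yes refl rewrite a≁t = ≤-refl
    ... | no _     | no _     rewrite +-identityʳ (𝟙 (adj G a b)) = 𝟙≤1 (adj G a b)

stuck-unreachable : ∀ {n} {R : Fin n → Fin n → Set} {u v} → (∀ w → ¬ R u w) → u ≢ v → ¬ Reach R u v
stuck-unreachable stuck u≢v here         = u≢v refl
stuck-unreachable stuck u≢v (step u→w _) = stuck _ u→w

unreachable-stuck : ∀ {n} {R : Fin n → Fin n → Set} {u v} → (∀ w → ¬ R w v) → u ≢ v → ¬ Reach R u v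
unreachable-stuck stuck u≢v here = u≢v refl
unreachable-stuck stuck u≢v (step u→w w⇝v) = unreachable-stuck stuck (λ { refl → stuck _ u→w }) w⇝v

first-step : ∀ {n} {R : Fin n → Fin n → Set} {u v} → u ≢ v → Reach R u v → ∃[ w ] R u w
first-step u≢v here         = contradiction refl u≢v
first-step u≢v (step u→w _) = _ , u→w

covered⇒≤ : ∀ {m k} (f : Fin m → Fin k) → (∀ c → ∃[ i ] f i ≡ c) → k ≤ m
covered⇒≤ f cover = injective⇒≤ section-injective
  where
  section-injective : ∀ {c d} → proj₁ (cover c) ≡ proj₁ (cover d) → c ≡ d
  section-injective {c} {d} eq =
    trans (sym (proj₂ (cover c))) (trans (cong f eq) (proj₂ (cover d)))

module MDColouring {n k} {G : Graph n} (Γ : Coloring G k) (md : IsMD Γ) where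

  separator-on-edge : ∀ {u v i} → Edge G u v → ¬ Reach (Without Γ i) u v → col Γ u v ≡ i
  separator-on-edge {u} {v} {i} u~v unreachable with col Γ u v ≟ i
  ... | yes uv≡i = uv≡i
  ... | no  uv≢i = contradiction (step (u~v , uv≢i) here) unreachable

  separator-on-path : ∀ {u w v i} → Edge G u w → Edge G w v → ¬ Reach (Without Γ i) u v →
                      col Γ u w ≡ i ⊎ col Γ w v ≡ i
  separator-on-path {u} {w} {v} {i} u~w w~v unreachable with col Γ u w ≟ i | col Γ w v ≟ i
  ... | yes uw≡i | _        = inj₁ uw≡i
  ... | no  _    | yes wv≡i = inj₂ wv≡i
  ... | no  uw≢i | no  wv≢i = contradiction (step (u~w , uw≢i) (step (w~v , wv≢i) here)) unreachable

  triangle-shares : ∀ {u w v} → Edge G u v → Edge G u w → Edge G w v →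
                    col Γ u v ≡ col Γ u w ⊎ col Γ u v ≡ col Γ w v
  triangle-shares u~v u~w w~v with md _ _ (edge-≢ G u~v)
  ... | i , unreachable with separator-on-path u~w w~v unreachable
  ...   | inj₁ uw≡i = inj₁ (trans (separator-on-edge u~v unreachable) (sym uw≡i))
  ...   | inj₂ wv≡i = inj₂ (trans (separator-on-edge u~v unreachable) (sym wv≡i))

  triangle : ∀ {x y z} → Edge G x y → Edge G y z → Edge G x z → col Γ x y ≡ col Γ x z
  triangle {x} {y} {z} x~y y~z x~z with triangle-shares x~y x~z (edge-sym G y~z)
  ... | inj₁ xy≡xz = xy≡xz
  ... | inj₂ xy≡zy with triangle-shares x~z x~y y~z
  ...   | inj₁ xz≡xy = sym xz≡xy
  ...   | inj₂ xz≡yz = trans (trans xy≡zy (col-sym Γ _ _ (edge-sym G y~z))) (sym xz≡yz)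

monochromatic-md : ∀ {n} {G : Graph n} → ∃[ x ] ∃[ y ] Edge G x y → MDColoring G 1
monochromatic-md {G = G} (x , y , x~y) = Γ , uses , separates
  where
  Γ : Coloring G 1
  Γ = record { col = λ _ _ → zero ; col-sym = λ _ _ _ → refl }
  uses : UsesAll Γ
  uses zero = x , y , x~y , refl
  separates : IsMD Γ
  separates u v u≢v = zero , stuck-unreachable (λ w without → proj₂ without refl) u≢v

-- The cherry bound and the dense case.

edge-bound-arith : ∀ c E → E + E + c * 3 + 2 ≤ (2 + c) * 2 + (2 + c) * c →
                   E ≤ choose2 (suc c) + 1
edge-bound-arith c E bound =
  half-≤ (+-cancelʳ-≤ (c * 3 + 2) (E + E) (B + B)
    (subst₂ _≤_ (+-assoc (E + E) (c * 3) 2) rhs bound))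
  where
  C B : ℕ
  C = choose2 (suc c)
  B = C + 1
  rhs : (2 + c) * 2 + (2 + c) * c ≡ B + B + (c * 3 + 2)
  rhs = begin
    (2 + c) * 2 + (2 + c) * c      ≡⟨ expand c ⟩
    suc c * c + (c * 3 + 4)       ≡⟨ cong (_+ (c * 3 + 4)) (sym (choose2-double c)) ⟩
    C + C + (c * 3 + 4)           ≡⟨ regroup C (c * 3) ⟩
    B + B + (c * 3 + 2)           ∎
    where
    open ≡-Reasoning
    expand : ∀ c → (2 + c) * 2 + (2 + c) * c ≡ suc c * c + (c * 3 + 4)
    expand = solve-∀
    regroup : ∀ C d → C + C + (d + 4) ≡ (C + 1) + (C + 1) + (d + 2)
    regroup = solve-∀

-- Then every other vertex misses one of x, y, z, so the graph misses at
-- least n − 2 edges: a degree count (rows outside {x,y,z}, columns of x, y, z) gives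
-- e(G) ≤ C(n − 1, 2) + 1.
module Cherry {c : ℕ} (G : Graph (2 + c)) {x y z : Fin (2 + c)}
  (x~y : Edge G x y) (x~z : Edge G x z) (y≢z : y ≢ z) (y≁z : adj G y z ≡ false)
  (no-common : ∀ w → ¬ (Edge G x w × Edge G y w × Edge G z w)) where

  x≢y : x ≢ y
  x≢y = edge-≢ G x~y

  x≢z : x ≢ z
  x≢z = edge-≢ G x~z

  inS : Fin (2 + c) → ℕ
  inS a = δ x a + δ y a + δ z a

  inS? : ∀ a → (a ≡ x ⊎ a ≡ y ⊎ a ≡ z) ⊎ (a ≢ x × a ≢ y × a ≢ z)
  inS? a with a ≟ x | a ≟ y | a ≟ z
  ... | yes a≡x | _       | _       = inj₁ (inj₁ a≡x)
  ... | no _    | yes a≡y | _       = inj₁ (inj₂ (inj₁ a≡y))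
  ... | no _    | no _    | yes a≡z = inj₁ (inj₂ (inj₂ a≡z))
  ... | no a≢x  | no a≢y  | no a≢z  = inj₂ (a≢x , a≢y , a≢z)

  inS-inside : ∀ {a} → a ≡ x ⊎ a ≡ y ⊎ a ≡ z → inS a ≡ 1
  inS-inside (inj₁ refl) =
    cong₂ _+_ (cong₂ _+_ (δ-self x) (δ-other x≢y)) (δ-other x≢z)
  inS-inside (inj₂ (inj₁ refl)) =
    cong₂ _+_ (cong₂ _+_ (δ-other (x≢y ∘ sym)) (δ-self y)) (δ-other y≢z)
  inS-inside (inj₂ (inj₂ refl)) =
    cong₂ _+_ (cong₂ _+_ (δ-other (x≢z ∘ sym)) (δ-other (y≢z ∘ sym))) (δ-self z)

  inS-outside : ∀ {a} → a ≢ x → a ≢ y → a ≢ z → inS a ≡ 0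
  inS-outside a≢x a≢y a≢z = cong₂ _+_ (cong₂ _+_ (δ-other a≢x) (δ-other a≢y)) (δ-other a≢z)

  deg-missing : ∀ {a t} → a ≢ t → adj G a t ≡ false → deg G a ≤ c
  deg-missing {a} a≢t a≁t =
    +-cancelʳ-≤ 2 (deg G a) c (subst (deg G a + 2 ≤_) (+-comm 2 c) (deg-nonadj G a≢t a≁t))

  deg-outside : ∀ {a} → a ≢ x → a ≢ y → a ≢ z → deg G a ≤ c
  deg-outside {a} a≢x a≢y a≢z with adj G a x in ax | adj G a y in ay | adj G a z in az
  ... | true  | true  | true  = contradiction (edge-sym G ax , edge-sym G ay , edge-sym G az) (no-common a)
  ... | false | _     | _     = deg-missing a≢x ax
  ... | true  | false | _     = deg-missing a≢y ay
  ... | true  | true  | false = deg-missing a≢z az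

  -- Row bound: outside {x, y, z} the degree is at most c.
  row : ∀ a → deg G a + c * inS a ≤ inS a * deg G a + c
  row a with inS? a
  ... | inj₁ a∈S rewrite inS-inside a∈S =
    ≤-reflexive (cong₂ _+_ (sym (+-identityʳ (deg G a))) (*-identityʳ c))
  ... | inj₂ (a≢x , a≢y , a≢z) rewrite inS-outside a≢x a≢y a≢z | *-zeroʳ c | +-identityʳ (deg G a) =
    deg-outside a≢x a≢y a≢z

  ∑-inS* : (h : Fin (2 + c) → ℕ) → ∑[ a < 2 + c ] (inS a * h a) ≡ h x + h y + h z
  ∑-inS* h = begin
    ∑[ a < 2 + c ] (inS a * h a)
      ≡⟨ sum-cong-≗ distrib ⟩
    ∑[ a < 2 + c ] (δ x a * h a + δ y a * h a + δ z a * h a)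
      ≡⟨ ∑-+₃ (λ a → δ x a * h a) (λ a → δ y a * h a) (λ a → δ z a * h a) ⟩
    ∑[ a < 2 + c ] (δ x a * h a) + ∑[ a < 2 + c ] (δ y a * h a) + ∑[ a < 2 + c ] (δ z a * h a)
      ≡⟨ cong₂ _+_ (cong₂ _+_ (∑-δ* x h) (∑-δ* y h)) (∑-δ* z h) ⟩
    h x + h y + h z ∎
    where
    open ≡-Reasoning
    distrib : ∀ a → inS a * h a ≡ δ x a * h a + δ y a * h a + δ z a * h a
    distrib a = trans (*-distribʳ-+ (h a) (δ x a + δ y a) (δ z a))
                      (cong (_+ δ z a * h a) (*-distribʳ-+ (h a) (δ x a) (δ y a)))

  ∑-inS : ∑[ a < 2 + c ] inS a ≡ 3
  ∑-inS = trans (sum-cong-≗ (λ a → sym (*-identityʳ (inS a)))) (∑-inS* (λ _ → 1))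

  rows : ∑[ a < 2 + c ] deg G a + c * 3 ≤ deg G x + deg G y + deg G z + (2 + c) * c
  rows = begin
    ∑[ a < 2 + c ] deg G a + c * 3
      ≡⟨ cong (λ t → ∑[ a < 2 + c ] deg G a + c * t) ∑-inS ⟨
    ∑[ a < 2 + c ] deg G a + c * ∑[ a < 2 + c ] inS a
      ≡⟨ cong (∑[ a < 2 + c ] deg G a +_) (*-distribˡ-sum c inS) ⟩
    ∑[ a < 2 + c ] deg G a + ∑[ a < 2 + c ] (c * inS a)
      ≡⟨ ∑-distrib-+ (deg G) (λ a → c * inS a) ⟨
    ∑[ a < 2 + c ] (deg G a + c * inS a)
      ≤⟨ ∑-mono row ⟩
    ∑[ a < 2 + c ] (inS a * deg G a + c)
      ≡⟨ ∑-distrib-+ (λ a → inS a * deg G a) (λ _ → c) ⟩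
    ∑[ a < 2 + c ] (inS a * deg G a) + ∑[ a < 2 + c ] c
      ≡⟨ cong₂ _+_ (∑-inS* (deg G)) (∑-const (2 + c) c) ⟩
    deg G x + deg G y + deg G z + (2 + c) * c ∎
    where open ≤-Reasoning

  -- Every vertex b is adjacent to at most two of x, y, z, and y, z to only one.
  column : ∀ b → 𝟙 (adj G x b) + 𝟙 (adj G y b) + 𝟙 (adj G z b) + (δ y b + δ z b) ≤ 2
  column b with b ≟ y | b ≟ z
  ... | yes refl | yes refl = contradiction refl y≢z
  ... | yes refl | no _ rewrite x~y | adj-irr G y | adj-sym G z y | y≁z = ≤-refl
  ... | no _ | yes refl rewrite x~z | y≁z | adj-irr G z = ≤-refl
  ... | no _ | no _ rewrite +-identityʳ (𝟙 (adj G x b) + 𝟙 (adj G y b) + 𝟙 (adj G z b)) =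
    𝟙-two-of-three (adj G x b) (adj G y b) (adj G z b) (no-common b)

  columns : deg G x + deg G y + deg G z + 2 ≤ (2 + c) * 2
  columns = begin
    deg G x + deg G y + deg G z + 2
      ≡⟨ cong₂ _+_ (∑-+₃ (λ b → 𝟙 (adj G x b)) (λ b → 𝟙 (adj G y b)) (λ b → 𝟙 (adj G z b)))
                   (trans (∑-distrib-+ (δ y) (δ z)) (cong₂ _+_ (∑-δ y) (∑-δ z))) ⟨
    ∑[ b < 2 + c ] (𝟙 (adj G x b) + 𝟙 (adj G y b) + 𝟙 (adj G z b)) + ∑[ b < 2 + c ] (δ y b + δ z b)
      ≡⟨ ∑-distrib-+ (λ b → 𝟙 (adj G x b) + 𝟙 (adj G y b) + 𝟙 (adj G z b)) (λ b → δ y b + δ z b) ⟨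
    ∑[ b < 2 + c ] (𝟙 (adj G x b) + 𝟙 (adj G y b) + 𝟙 (adj G z b) + (δ y b + δ z b))
      ≤⟨ ∑-mono column ⟩
    ∑[ b < 2 + c ] 2
      ≡⟨ ∑-const (2 + c) 2 ⟩
    (2 + c) * 2 ∎
    where open ≤-Reasoning

  few-edges : e G ≤ choose2 (suc c) + 1
  few-edges = edge-bound-arith c (e G) (begin
    e G + e G + c * 3 + 2                           ≡⟨ cong (λ t → t + c * 3 + 2) (handshake G) ⟨
    ∑[ a < 2 + c ] deg G a + c * 3 + 2              ≤⟨ +-monoˡ-≤ 2 rows ⟩
    degrees + (2 + c) * c + 2                       ≡⟨ xy∙z≈xz∙y degrees ((2 + c) * c) 2 ⟩
    degrees + 2 + (2 + c) * c                       ≤⟨ +-monoˡ-≤ ((2 + c) * c) columns ⟩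
    (2 + c) * 2 + (2 + c) * c                       ∎)
    where
    open ≤-Reasoning
    degrees : ℕ
    degrees = deg G x + deg G y + deg G z

module Dense {c : ℕ} (G : Graph (2 + c)) (dense : choose2 (suc c) + 2 ≤ e G) where

  common-neighbour : ∀ {x y z} → Edge G x y → Edge G x z → y ≢ z → adj G y z ≡ false →
                     ∃[ w ] (Edge G x w × Edge G y w × Edge G z w)
  common-neighbour {x} {y} {z} x~y x~z y≢z y≁z with any? (common-neighbour? G x y z)
  ... | yes found = found
  ... | no  none  = contradiction (≤-trans dense (Cherry.few-edges G x~y x~z y≢z y≁z no-common))
                                  (1+n≰n ∘ +-cancelˡ-≤ (choose2 (suc c)) 2 1)
    where
    no-common : ∀ w → ¬ (Edge G x w × Edge G y w × Edge G z w)
    no-common w common = none (w , common)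

  module _ {k : ℕ} (Γ : Coloring G k) (md : IsMD Γ) where
    open MDColouring Γ md using (triangle)

    -- Two edges at a common vertex have the same colour: they lie in a triangle, or in two
    -- triangles through a common neighbour.
    star : ∀ {x y z} → Edge G x y → Edge G x z → col Γ x y ≡ col Γ x z
    star {x} {y} {z} x~y x~z with y ≟ z
    ... | yes refl = refl
    ... | no y≢z with adj G y z in y~z?
    ...   | true  = triangle x~y y~z? x~z
    ...   | false with common-neighbour x~y x~z y≢z y~z?
    ...     | w , x~w , y~w , z~w = trans (triangle x~y y~w x~w) (triangle x~w (edge-sym G z~w) x~z)

    along : ∀ {u v p q} → Edge G u v → Reach (Edge G) v p → Edge G p q → col Γ u v ≡ col Γ p q
    along {u} {v} u~v here           p~q = trans (col-sym Γ u v u~v) (star (edge-sym G u~v) p~q)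
    along {u} {v} u~v (step v~w w⇝p) p~q =
      trans (trans (col-sym Γ u v u~v) (star (edge-sym G u~v) v~w)) (along v~w w⇝p p~q)

md-dense : ∀ {c} (G : Graph (2 + c)) → Connected G → choose2 (suc c) + 2 ≤ e G → MdIs G 1
md-dense G connected dense = monochromatic-md (zero , edge-from-zero) , at-most-one
  where
  edge-from-zero : ∃[ w ] Edge G zero w
  edge-from-zero = first-step (λ ()) (connected zero (suc zero))
  at-most-one : ∀ k → MDColoring G k → k ≤ 1
  at-most-one k (Γ , uses , md) = covered⇒≤ (λ _ → col Γ zero (proj₁ edge-from-zero)) cover
    where
    cover : ∀ i → ∃[ _ ] col Γ zero (proj₁ edge-from-zero) ≡ i
    cover i with uses i
    ... | x , y , x~y , xy≡i =
      zero , trans (Dense.along G dense Γ md (proj₂ edge-from-zero) (connected _ x) x~y) xy≡i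

module Pendant (m : ℕ) where

  G : Graph (3 + m)
  G = pendantK (3 + m)

  ℓ : Fin (3 + m)
  ℓ = fromℕ (2 + m)

  v₀ one : Fin (3 + m)
  v₀  = zero
  one = suc zero

  ℓ≢v₀ : ℓ ≢ v₀
  ℓ≢v₀ ()

  v₀≢ℓ : v₀ ≢ ℓ
  v₀≢ℓ ()

  one≢ℓ : one ≢ ℓ
  one≢ℓ ()

  toℕ-≢ : ∀ {a b : Fin (3 + m)} → a ≢ b → (toℕ a ≡ᵇ toℕ b) ≡ false
  toℕ-≢ a≢b = ¬-not (λ eq → a≢b (toℕ-injective (≡ᵇ⇒≡ _ _ (Equivalence.from T-≡ eq))))

  isLast-ℓ : isLast (3 + m) ℓ ≡ true
  isLast-ℓ = subst (λ i → (i ≡ᵇ 2 + m) ≡ true) (sym (toℕ-fromℕ (2 + m))) (≡ᵇ-refl (2 + m))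

  isLast-other : ∀ {a} → a ≢ ℓ → isLast (3 + m) a ≡ false
  isLast-other a≢ℓ = ¬-not (λ eq →
    a≢ℓ (toℕ-injective (trans (≡ᵇ⇒≡ _ _ (Equivalence.from T-≡ eq)) (sym (toℕ-fromℕ (2 + m))))))

  clique-edge : ∀ {a b} → a ≢ b → a ≢ ℓ → b ≢ ℓ → Edge G a b
  clique-edge a≢b a≢ℓ b≢ℓ rewrite toℕ-≢ a≢b | isLast-other a≢ℓ | isLast-other b≢ℓ = refl

  pendant-edge : Edge G v₀ ℓ
  pendant-edge rewrite isLast-ℓ = refl

  ℓ-only-to-v₀ : ∀ {b} → b ≢ v₀ → adj G ℓ b ≡ false
  ℓ-only-to-v₀ {b} b≢v₀ with b ≟ ℓ
  ... | yes refl = adj-irr G ℓ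
  ... | no b≢ℓ rewrite toℕ-≢ (b≢ℓ ∘ sym) | isLast-ℓ | isLast-other b≢ℓ | toℕ-≢ b≢v₀ = refl

  ℓ-neighbour : ∀ {b} → Edge G ℓ b → b ≡ v₀
  ℓ-neighbour {b} ℓ~b with b ≟ v₀
  ... | yes b≡v₀ = b≡v₀
  ... | no b≢v₀  = contradiction (trans (sym (ℓ-only-to-v₀ b≢v₀)) ℓ~b) λ ()

  edge-kinds : ∀ {a b} → Edge G a b → (a ≢ ℓ × b ≢ ℓ) ⊎ (a ≡ ℓ × b ≡ v₀) ⊎ (a ≡ v₀ × b ≡ ℓ)
  edge-kinds {a} {b} a~b with a ≟ ℓ | b ≟ ℓ
  ... | yes refl | _        = inj₂ (inj₁ (refl , ℓ-neighbour a~b))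
  ... | no _     | yes refl = inj₂ (inj₂ (ℓ-neighbour (edge-sym G {a} {ℓ} a~b) , refl))
  ... | no a≢ℓ   | no b≢ℓ   = inj₁ (a≢ℓ , b≢ℓ)

  -- Degrees: ℓ has the single neighbour v₀; a clique vertex a has m + 1 neighbours in the
  -- clique, plus ℓ when a = v₀.
  ℓ-row : ∀ b → 𝟙 (adj G ℓ b) ≡ δ v₀ b
  ℓ-row b with b ≟ v₀
  ... | yes refl = cong 𝟙 (edge-sym G {v₀} {ℓ} pendant-edge)
  ... | no b≢v₀  = cong 𝟙 (ℓ-only-to-v₀ b≢v₀)

  deg-ℓ : deg G ℓ ≡ 1
  deg-ℓ = trans (sum-cong-≗ ℓ-row) (∑-δ v₀)

  deg-clique : ∀ {a} → a ≢ ℓ → deg G a + 2 ≡ 3 + m + δ v₀ a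
  deg-clique {a} a≢ℓ = begin
    deg G a + 2                                      ≡⟨ row-with-two G a ℓ ⟨
    ∑[ b < 3 + m ] (𝟙 (adj G a b) + (δ a b + δ ℓ b)) ≡⟨ sum-cong-≗ counted-once ⟩
    ∑[ b < 3 + m ] (1 + δ ℓ b * δ v₀ a)            ≡⟨ ∑-distrib-+ (λ _ → 1) (λ b → δ ℓ b * δ v₀ a) ⟩
    ∑[ b < 3 + m ] 1 + ∑[ b < 3 + m ] (δ ℓ b * δ v₀ a)
      ≡⟨ cong₂ _+_ (trans (∑-const (3 + m) 1) (*-identityʳ (3 + m))) (∑-δ* ℓ (λ _ → δ v₀ a)) ⟩
    3 + m + δ v₀ a                                 ∎
    where
    open ≡-Reasoning
    -- Each b is a neighbour of a, or a itself, or ℓ; only ℓ = b can be both (when a = v₀).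
    counted-once : ∀ b → 𝟙 (adj G a b) + (δ a b + δ ℓ b) ≡ 1 + δ ℓ b * δ v₀ a
    counted-once b with b ≟ a | b ≟ ℓ
    ... | yes refl | yes refl = contradiction refl a≢ℓ
    ... | yes refl | no _     rewrite adj-irr G a = refl
    ... | no _     | yes refl rewrite adj-sym G a ℓ | ℓ-row a =
      trans (+-comm (δ v₀ a) 1) (cong suc (sym (+-identityʳ (δ v₀ a))))
    ... | no b≢a   | no b≢ℓ   rewrite clique-edge (b≢a ∘ sym) a≢ℓ b≢ℓ = refl

  degree-sum : ∑[ a < 3 + m ] deg G a + (3 + m) * 2 + m ≡ (3 + m) * (3 + m) + 1
  degree-sum = begin
    ∑[ a < 3 + m ] deg G a + (3 + m) * 2 + m
      ≡⟨ cong₂ _+_ (cong (∑[ a < 3 + m ] deg G a +_) (∑-const (3 + m) 2)) (∑-δ* ℓ (λ _ → m)) ⟨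
    ∑[ a < 3 + m ] deg G a + ∑[ a < 3 + m ] 2 + ∑[ a < 3 + m ] (δ ℓ a * m)
      ≡⟨ ∑-+₃ (deg G) (λ _ → 2) (λ a → δ ℓ a * m) ⟨
    ∑[ a < 3 + m ] (deg G a + 2 + δ ℓ a * m)
      ≡⟨ sum-cong-≗ vertex ⟩
    ∑[ a < 3 + m ] (3 + m + δ v₀ a)
      ≡⟨ ∑-distrib-+ (λ _ → 3 + m) (δ v₀) ⟩
    ∑[ a < 3 + m ] (3 + m) + ∑[ a < 3 + m ] δ v₀ a
      ≡⟨ cong₂ _+_ (∑-const (3 + m) (3 + m)) (∑-δ v₀) ⟩
    (3 + m) * (3 + m) + 1 ∎
    where
    open ≡-Reasoning
    vertex : ∀ a → deg G a + 2 + δ ℓ a * m ≡ 3 + m + δ v₀ a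
    vertex a with a ≟ ℓ
    ... | yes refl rewrite deg-ℓ | δ-other ℓ≢v₀ = refl
    ... | no a≢ℓ   rewrite +-identityʳ (deg G a + 2) = deg-clique a≢ℓ

  edge-count : e G ≡ choose2 (2 + m) + 1
  edge-count = half-≡ (+-cancelʳ-≡ ((3 + m) * 2 + m) (e G + e G) (B + B) (begin
    e G + e G + ((3 + m) * 2 + m)              ≡⟨ +-assoc (e G + e G) _ m ⟨
    e G + e G + (3 + m) * 2 + m                ≡⟨ cong (λ t → t + (3 + m) * 2 + m) (handshake G) ⟨
    ∑[ a < 3 + m ] deg G a + (3 + m) * 2 + m   ≡⟨ degree-sum ⟩
    (3 + m) * (3 + m) + 1                      ≡⟨ expand m ⟩
    suc (suc m) * suc m + (2 + ((3 + m) * 2 + m))  ≡⟨ cong (_+ (2 + ((3 + m) * 2 + m))) (choose2-double (suc m)) ⟨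
    C + C + (2 + ((3 + m) * 2 + m))            ≡⟨ regroup C ((3 + m) * 2 + m) ⟩
    B + B + ((3 + m) * 2 + m)                  ∎))
    where
    open ≡-Reasoning
    C B : ℕ
    C = choose2 (2 + m)
    B = C + 1
    expand : ∀ m → (3 + m) * (3 + m) + 1 ≡ suc (suc m) * suc m + (2 + ((3 + m) * 2 + m))
    expand = solve-∀
    regroup : ∀ C d → C + C + (2 + d) ≡ (C + 1) + (C + 1) + d
    regroup = solve-∀

  Γ₂ : Coloring G 2
  Γ₂ = record
    { col     = λ a b → colour (does (a ≟ ℓ) ∨ does (b ≟ ℓ))
    ; col-sym = λ a b _ → cong colour (∨-comm (does (a ≟ ℓ)) (does (b ≟ ℓ)))
    }
    where
    colour : Bool → Fin 2
    colour touches-ℓ = if touches-ℓ then suc zero else zero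

  clique-colour : ∀ {a b} → a ≢ ℓ → b ≢ ℓ → col Γ₂ a b ≡ zero
  clique-colour {a} {b} a≢ℓ b≢ℓ with a ≟ ℓ | b ≟ ℓ
  ... | yes a≡ℓ | _       = contradiction a≡ℓ a≢ℓ
  ... | no _    | yes b≡ℓ = contradiction b≡ℓ b≢ℓ
  ... | no _    | no _    = refl

  pendant-colour : ∀ {a b} → a ≡ ℓ ⊎ b ≡ ℓ → col Γ₂ a b ≡ suc zero
  pendant-colour {a} {b} a∨b≡ℓ with a ≟ ℓ | b ≟ ℓ
  ... | yes _ | _     = refl
  ... | no _  | yes _ = refl
  ... | no a≢ℓ | no b≢ℓ = contradiction a∨b≡ℓ [ a≢ℓ , b≢ℓ ]

  inner-colour : ∀ {a w} → a ≢ ℓ → a ≢ v₀ → Edge G a w → col Γ₂ a w ≡ zero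
  inner-colour a≢ℓ a≢v₀ a~w with edge-kinds a~w
  ... | inj₁ (_ , w≢ℓ)        = clique-colour a≢ℓ w≢ℓ
  ... | inj₂ (inj₁ (a≡ℓ , _)) = contradiction a≡ℓ a≢ℓ
  ... | inj₂ (inj₂ (a≡v₀ , _)) = contradiction a≡v₀ a≢v₀

  -- Deleting colour 1 isolates ℓ; deleting colour 0 isolates every clique vertex other than v₀.
  md₂ : IsMD Γ₂
  md₂ u v u≢v with u ≟ ℓ | v ≟ ℓ
  ... | yes refl | _ =
    suc zero , stuck-unreachable (λ w without → proj₂ without (pendant-colour {ℓ} {w} (inj₁ refl))) u≢v
  ... | no _ | yes refl =
    suc zero , unreachable-stuck (λ w without → proj₂ without (pendant-colour {w} {ℓ} (inj₂ refl))) u≢v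
  ... | no u≢ℓ | no v≢ℓ with u ≟ v₀
  ...   | no u≢v₀ =
    zero , stuck-unreachable (λ w (u~w , c≢0) → c≢0 (inner-colour u≢ℓ u≢v₀ u~w)) u≢v
  ...   | yes refl =
    zero , unreachable-stuck (λ w (w~v , c≢0) →
      c≢0 (trans (col-sym Γ₂ w v w~v) (inner-colour v≢ℓ (u≢v ∘ sym) (edge-sym G {w} {v} w~v)))) u≢v

  uses₂ : UsesAll Γ₂
  uses₂ zero       = v₀ , one , clique-edge (λ ()) v₀≢ℓ one≢ℓ , clique-colour v₀≢ℓ one≢ℓ
  uses₂ (suc zero) = v₀ , ℓ , pendant-edge , pendant-colour {v₀} {ℓ} (inj₂ refl)

  -- In any MD-colouring the clique is monochromatic, so only the colours of the edges v₀ one and v₀ ℓ occur.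
  module Upper {k : ℕ} (Γ : Coloring G k) (md : IsMD Γ) where
    open MDColouring Γ md using (triangle)

    from-v₀ : ∀ {b} → b ≢ v₀ → b ≢ ℓ → col Γ v₀ b ≡ col Γ v₀ one
    from-v₀ {b} b≢v₀ b≢ℓ with b ≟ one
    ... | yes refl = refl
    ... | no b≢1   = triangle (clique-edge (b≢v₀ ∘ sym) v₀≢ℓ b≢ℓ) (clique-edge b≢1 b≢ℓ one≢ℓ)
                              (clique-edge (λ ()) v₀≢ℓ one≢ℓ)

    clique-monochromatic : ∀ {a b} → a ≢ b → a ≢ ℓ → b ≢ ℓ → col Γ a b ≡ col Γ v₀ one
    clique-monochromatic {a} {b} a≢b a≢ℓ b≢ℓ with a ≟ v₀ | b ≟ v₀
    ... | yes refl | _        = from-v₀ (a≢b ∘ sym) b≢ℓ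
    ... | no a≢v₀  | yes refl = trans (col-sym Γ a v₀ (clique-edge a≢b a≢ℓ v₀≢ℓ)) (from-v₀ a≢v₀ a≢ℓ)
    ... | no a≢v₀  | no b≢v₀  =
      trans (triangle (clique-edge a≢b a≢ℓ b≢ℓ) (clique-edge b≢v₀ b≢ℓ v₀≢ℓ) a~v₀)
            (trans (col-sym Γ a v₀ a~v₀) (from-v₀ a≢v₀ a≢ℓ))
      where
      a~v₀ : Edge G a v₀
      a~v₀ = clique-edge a≢v₀ a≢ℓ v₀≢ℓ

    two-colours : ∀ {a b} → Edge G a b → col Γ a b ≡ col Γ v₀ one ⊎ col Γ a b ≡ col Γ v₀ ℓ
    two-colours a~b with edge-kinds a~b
    ... | inj₁ (a≢ℓ , b≢ℓ)       = inj₁ (clique-monochromatic (edge-≢ G a~b) a≢ℓ b≢ℓ)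
    ... | inj₂ (inj₁ (refl , refl)) = inj₂ (col-sym Γ ℓ v₀ a~b)
    ... | inj₂ (inj₂ (refl , refl)) = inj₂ refl

  at-most-two : ∀ k → MDColoring G k → k ≤ 2
  at-most-two k (Γ , uses , md) = covered⇒≤ colour-of cover
    where
    colour-of : Fin 2 → Fin k
    colour-of zero       = col Γ v₀ one
    colour-of (suc zero) = col Γ v₀ ℓ
    cover : ∀ i → ∃[ j ] colour-of j ≡ i
    cover i with uses i
    ... | a , b , a~b , ab≡i with Upper.two-colours Γ md a~b
    ...   | inj₁ ab≡v₀1 = zero , trans (sym ab≡v₀1) ab≡i
    ...   | inj₂ ab≡v₀ℓ = suc zero , trans (sym ab≡v₀ℓ) ab≡i

  sharp : e G ≡ choose2 (2 + m) + 1 × MdIs G 2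
  sharp = edge-count , (Γ₂ , uses₂ , md₂) , at-most-two

-- The theorem.  The dense case holds for every n ≥ 2 and the pendant case for every n ≥ 3;
-- the hypothesis n ≥ 4 is only used to exclude the smaller n.
lemma3p2 : (∀ (n : ℕ) (G : Graph n) → 4 ≤ n → Connected G → choose2 (n ∸ 1) + 2 ≤ e G → MdIs G 1)
           × (∀ (n : ℕ) → 4 ≤ n → (e (pendantK n) ≡ choose2 (n ∸ 1) + 1) × MdIs (pendantK n) 2)
lemma3p2 = dense-case , pendant-case
  where
  dense-case : ∀ (n : ℕ) (G : Graph n) → 4 ≤ n → Connected G → choose2 (n ∸ 1) + 2 ≤ e G → MdIs G 1
  dense-case (suc (suc c)) G _   = md-dense G
  dense-case (suc zero)    G (s≤s ())

  pendant-case : ∀ (n : ℕ) → 4 ≤ n → (e (pendantK n) ≡ choose2 (n ∸ 1) + 1) × MdIs (pendantK n) 2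
  pendant-case (suc (suc (suc m))) _ = Pendant.sharp m
  pendant-case (suc zero)       (s≤s ())
  pendant-case (suc (suc zero)) (s≤s (s≤s ()))
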